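{- Let $m>n\ge1$ be coprime, $\alpha=\epsilon_i-\delta_j$, $\lambda\in X_\alpha$, $\Lambda=x(\lambda)$ and $\Lambda^+=\tau_\alpha(\Lambda)$. If $(\Lambda^+,\beta)=0$ for $\beta=\epsilon_k-\delta_j$ with $k\in[n]$, then one of the following holds: (a) $k=i-1$, $\lambda_{n+1-i}=\lambda_{n+2-i}$ and $\beta=\epsilon_{i-1}-\delta_j$; (b) $\alpha=\epsilon_1-\delta_1$, $\beta=\epsilon_n-\delta_1$, $\lambda_1=m$, $\lambda_n=0$, and $(m,1^{n-1})\subseteq t_\alpha(\lambda)$.
   Context: $X$: partitions $\lambda=(\lambda_1\ge\dots\ge\lambda_n\ge0)$ with $\lambda_1\le m$, drawn in the grid with rows $\epsilon_1,\dots,\epsilon_n$ (top to bottom) and columns $\delta_1,\dots,\delta_m$, with $\lambda_k$ left-justified boxes in row $\epsilon_{n+1-k}$; $\lambda'_j=|\{k:\lambda_k\ge j\}|$; containment is containment of diagrams. $X_\alpha$: those $\lambda$ for which box $\epsilon_i-\delta_j$ is an outer corner; $t_\alpha$ adds that box. Elements of $\mathbb Z^{n|m}$: $(a_1,\dots,a_n|b_1,\dots,b_m)=\sum a_p\epsilon_p-\sum b_q\delta_q$, with $(\Lambda,\epsilon_p-\delta_q)=a_p-b_q$. $x(\lambda)$ has $a_p=m(n-p)+n\lambda_{n+1-p}$, $b_q=n(q-1)+m\lambda'_q$. $\tau_\alpha(\Lambda)=\Lambda+n\epsilon_i-m\delta_j$ (add $n$ to $a_i$ and $m$ to $b_j$).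 -}

module Defs where

open import Data.Nat using (ℕ; zero; suc; _+_; _*_; _∸_; _≤_; _<_; _≤ᵇ_; _≡ᵇ_)
open import Data.Integer as ℤ using (ℤ; +_)
open import Data.Vec using (Vec; []; _∷_; replicate)
open import Data.Bool using (if_then_else_)
open import Data.Product using (_×_)
open import Relation.Binary.PropositionalEquality using (_≡_)

-- A partition la = (λ₁ ≥ … ≥ λₙ ≥ 0) is stored as a vector (λ₁ , … , λₙ).
-- 1-based access: la ! k = λ_k for 1 ≤ k ≤ n (and 0 outside this range).
infixl 9 _!_
_!_ : ∀ {n} → Vec ℕ n → ℕ → ℕ
[] ! _ = 0
(x ∷ xs) ! zero = 0
(x ∷ xs) ! suc zero = x
(x ∷ xs) ! suc (suc k) = xs ! suc k

IsPartition : (n m : ℕ) → Vec ℕ n → Set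
IsPartition n m la =
  (∀ k → 1 ≤ k → k < n → la ! suc k ≤ la ! k) × (la ! 1 ≤ m)

conj : ∀ {n} → Vec ℕ n → ℕ → ℕ
conj [] q = 0
conj (x ∷ xs) q = (if q ≤ᵇ x then 1 else 0) + conj xs q

-- Row ε_i contains λ_{n+1-i} boxes. The box ε_i - δ_j (i ∈ [n], j ∈ [m])
-- is an outer (addable) corner of λ: row ε_i has exactly j-1 boxes and,
-- if i < n, the row ε_{i+1} below it (of length λ_{n-i}) has at least j boxes.
OuterCorner : (n m : ℕ) → ℕ → ℕ → Vec ℕ n → Set
OuterCorner n m i j la =
  (la ! suc (n ∸ i)) + 1 ≡ j × (i < n → j ≤ la ! (n ∸ i))

InX : (n m i j : ℕ) → Vec ℕ n → Set
InX n m i j la = IsPartition n m la × OuterCorner n m i j la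

incAt : ∀ {n} → ℕ → Vec ℕ n → Vec ℕ n
incAt k [] = []
incAt zero (x ∷ xs) = x ∷ xs
incAt (suc zero) (x ∷ xs) = suc x ∷ xs
incAt (suc (suc k)) (x ∷ xs) = x ∷ incAt (suc k) xs

-- t_α(λ): add the box ε_i - δ_j, i.e. increase λ_{n+1-i} by one
tα : ∀ {n} → ℕ → ℕ → Vec ℕ n → Vec ℕ n
tα {n} i j la = incAt (suc (n ∸ i)) la

_⊆_ : ∀ {n} → Vec ℕ n → Vec ℕ n → Set
μ ⊆ ν = ∀ k → μ ! k ≤ ν ! k

hook : (n m : ℕ) → Vec ℕ n
hook zero m = []
hook (suc n) m = m ∷ replicate n 1

-- elements of ℤ^{n|m}: (a₁,…,aₙ | b₁,…,b_m) = Σ a_p ε_p - Σ b_q δ_q (1-based)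
record Weight : Set where
  constructor wt
  field
    a : ℕ → ℤ
    b : ℕ → ℤ
open Weight public

-- (Λ , ε_p - δ_q) = a_p - b_q
pair : Weight → ℕ → ℕ → ℤ
pair Λ p q = a Λ p ℤ.- b Λ q

x : (n m : ℕ) → Vec ℕ n → Weight
x n m la = wt (λ p → + (m * (n ∸ p) + n * (la ! suc (n ∸ p))))
             (λ q → + (n * (q ∸ 1) + m * conj la q))

τ : (n m i j : ℕ) → Weight → Weight
τ n m i j Λ = wt (λ p → if p ≡ᵇ i then a Λ p ℤ.+ + n else a Λ p)
                 (λ q → if q ≡ᵇ j then b Λ q ℤ.+ + m else b Λ q)

-- Write r = n - i and c = λ_{n+1-i}.  At the outer corner c = j - 1 and λ'_j = r, so
-- (τ_α Λ, ε_k - δ_j) = 0 reads  m (n-k) + n λ_{n+1-k} (+ n if k = i) = n c + m (r+1).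
-- For k = i this says n = m.  Otherwise the equation forces n to divide m times the
-- difference of n - k and r + 1; as m and n are coprime and this difference is less
-- than n in absolute value unless i = 1 and k = n, either k = i - 1 (and then the two
-- rows have equal length) or λ_1 = λ_n + m, which together with λ_1 ≤ m gives case (b).
module Submission where

open import Defs
open import Data.Nat using (ℕ; zero; suc; _+_; _*_; _∸_; _≤_; _<_; _≤ᵇ_; _≡ᵇ_; z≤n; s≤s; _<?_; _≟_; pred; NonZero; >-nonZero)
open import Data.Nat.Properties
open import Data.Nat.Tactic.RingSolver using (solve-∀)
open import Data.Nat.Divisibility using (_∣_; ∣⇒≤; ∣m+n∣m⇒∣n; m∣m*n)
open import Data.Nat.Coprimality as Coprimality using (Coprime; coprime-divisor)
open import Data.Integer as ℤ using (+_; 0ℤ)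
open import Data.Integer.Properties using (+-injective; i-j≡0⇒i≡j)
open import Data.Vec using (Vec; []; _∷_; replicate)
open import Data.Bool using (true; false)
open import Data.Empty using (⊥-elim)
open import Data.Product using (_×_; _,_)
open import Data.Sum using (_⊎_; inj₁; inj₂)
open import Relation.Nullary using (yes; no; contradiction)
open import Relation.Binary.PropositionalEquality

private variable
  n m p q i j k : ℕ

!-beyond : (v : Vec ℕ n) → n < k → v ! k ≡ 0
!-beyond []       _ = refl
!-beyond {k = suc (suc k)} (_ ∷ xs) (s≤s n<1+k) = !-beyond xs n<1+k

!-∷ : ∀ x (xs : Vec ℕ n) → 1 ≤ k → (x ∷ xs) ! suc k ≡ xs ! k
!-∷ {k = suc k} _ _ _ = refl

Decreasing : Vec ℕ n → Set
Decreasing v = ∀ k → 1 ≤ k → v ! suc k ≤ v ! k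

partition⇒decreasing : (v : Vec ℕ n) → IsPartition n m v → Decreasing v
partition⇒decreasing {n} v (dec , _) k 1≤k with k <? n
... | yes k<n = dec k 1≤k k<n
... | no  k≮n = subst (_≤ v ! k) (sym (!-beyond v (s≤s (≮⇒≥ k≮n)))) z≤n

decreasing-tail : ∀ x (xs : Vec ℕ n) → Decreasing (x ∷ xs) → Decreasing xs
decreasing-tail _ _ d (suc k) _ = d (suc (suc k)) (s≤s z≤n)

decreasing-antitone : (v : Vec ℕ n) → Decreasing v → 1 ≤ p → p ≤ q → v ! q ≤ v ! p
decreasing-antitone {q = zero}  _ _ 1≤p p≤0 = contradiction (≤-trans 1≤p p≤0) λ ()
decreasing-antitone {q = suc q} v d 1≤p p≤1+q with m≤n⇒m<n∨m≡n p≤1+q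
... | inj₁ (s≤s p≤q) = ≤-trans (d q (≤-trans 1≤p p≤q)) (decreasing-antitone v d 1≤p p≤q)
... | inj₂ refl      = ≤-refl

conj-≡ : (v : Vec ℕ n) → Decreasing v → (1 ≤ p → q ≤ v ! p) → v ! suc p < q → conj v q ≡ p
conj-≡ {p = zero}  []       _ _ _ = refl
conj-≡ {p = suc p} []       _ q≤0 0<q = contradiction (q≤0 (s≤s z≤n)) (<⇒≱ 0<q)
conj-≡ {p = zero}  {q} (x ∷ xs) d _ x<q with q ≤ᵇ x | ≤ᵇ⇒≤ q x
... | false | _   = conj-≡ xs (decreasing-tail x xs d) (λ ()) (≤-<-trans (d 1 ≤-refl) x<q)
... | true  | q≤x = contradiction (q≤x _) (<⇒≱ x<q)
conj-≡ {p = suc p} {q} (x ∷ xs) d q≤vp vp<q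
  with q ≤ᵇ x | ≤⇒≤ᵇ (≤-trans (q≤vp (s≤s z≤n)) (decreasing-antitone {q = suc p} (x ∷ xs) d ≤-refl (s≤s z≤n)))
... | false | ()
... | true  | _ = cong suc (conj-≡ xs (decreasing-tail x xs d) q≤xsp vp<q)
  where
  q≤xsp : 1 ≤ p → q ≤ xs ! p
  q≤xsp 1≤p = subst (q ≤_) (!-∷ x xs 1≤p) (q≤vp (s≤s z≤n))

!-incAt : (v : Vec ℕ n) → 1 ≤ k → k ≤ n → incAt k v ! k ≡ suc (v ! k)
!-incAt {k = 1}           (x ∷ xs) _ _ = refl
!-incAt {k = suc (suc k)} (x ∷ xs) _ (s≤s k<n) = !-incAt xs (s≤s z≤n) k<n

!-≤-incAt : (v : Vec ℕ n) → v ! k ≤ incAt p v ! k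
!-≤-incAt []                                               = z≤n
!-≤-incAt {k = zero}                          (x ∷ xs) = z≤n
!-≤-incAt {k = suc k}       {p = zero}        (x ∷ xs) = ≤-refl
!-≤-incAt {k = 1}           {p = 1}           (x ∷ xs) = n≤1+n x
!-≤-incAt {k = suc (suc k)} {p = 1}           (x ∷ xs) = ≤-refl
!-≤-incAt {k = 1}           {p = suc (suc p)} (x ∷ xs) = ≤-refl
!-≤-incAt {k = suc (suc k)} {p = suc (suc p)} (x ∷ xs) = !-≤-incAt xs

replicate-⊆ : ∀ {x} (v : Vec ℕ n) → (∀ k → 1 ≤ k → k ≤ n → x ≤ v ! k) → replicate n x ⊆ v
replicate-⊆ []       _ _              = z≤n
replicate-⊆ (y ∷ ys) _ zero           = z≤n
replicate-⊆ (y ∷ ys) h 1              = h 1 ≤-refl (s≤s z≤n)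
replicate-⊆ (y ∷ ys) h (suc (suc k)) = replicate-⊆ ys h′ (suc k)
  where
  h′ : ∀ k → 1 ≤ k → k ≤ _ → _ ≤ ys ! k
  h′ k 1≤k k≤n = subst (_ ≤_) (!-∷ y ys 1≤k) (h (suc k) (s≤s z≤n) (s≤s k≤n))

hook-⊆ : (μ : Vec ℕ n) → m ≤ μ ! 1 → (∀ k → 2 ≤ k → k ≤ n → 1 ≤ μ ! k) → hook n m ⊆ μ
hook-⊆ []       _   _ _             = z≤n
hook-⊆ (y ∷ ys) _   _ zero          = z≤n
hook-⊆ (y ∷ ys) m≤y _ 1             = m≤y
hook-⊆ (y ∷ ys) _   h (suc (suc k)) = replicate-⊆ ys h′ (suc k)
  where
  h′ : ∀ k → 1 ≤ k → k ≤ _ → 1 ≤ ys ! k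
  h′ k 1≤k k≤n = subst (1 ≤_) (!-∷ y ys 1≤k) (h (suc k) (s≤s 1≤k) (s≤s k≤n))

hook-⊆-incAt : (v : Vec ℕ (suc p)) → Decreasing v → m ≤ v ! 1 → (1 ≤ p → 1 ≤ v ! p) →
               hook (suc p) m ⊆ incAt (suc p) v
hook-⊆-incAt {p} v d m≤v₁ 1≤vp = hook-⊆ (incAt (suc p) v) (≤-trans m≤v₁ (!-≤-incAt v)) 1≤incAt
  where
  1≤incAt : ∀ k → 2 ≤ k → k ≤ suc p → 1 ≤ incAt (suc p) v ! k
  1≤incAt k 2≤k k≤1+p with m≤n⇒m<n∨m≡n k≤1+p
  ... | inj₂ refl = subst (1 ≤_) (sym (!-incAt v (s≤s z≤n) ≤-refl)) (s≤s z≤n)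
  ... | inj₁ (s≤s k≤p) =
    ≤-trans (1≤vp (≤-trans 1≤k k≤p)) (≤-trans (decreasing-antitone v d 1≤k k≤p) (!-≤-incAt v))
    where 1≤k = ≤-trans (n≤1+n 1) 2≤k

∸≡suc[∸]⇒suc≡ : i ≤ n → n ∸ k ≡ suc (n ∸ i) → suc k ≡ i
∸≡suc[∸]⇒suc≡ {i} {n} {k} i≤n eq = ∸-cancelˡ-≡ k<n i≤n (begin
  n ∸ suc k      ≡⟨ pred[m∸n]≡m∸[1+n] n k ⟨
  pred (n ∸ k)   ≡⟨ cong pred eq ⟩
  n ∸ i          ∎)
  where
  open ≡-Reasoning
  k<n : k < n
  k<n = m∸n≢0⇒n<m (subst (_≢ 0) (sym eq) λ ())

n*a≡n*b+m*d⇒d≡0∨n≤d : ∀ {a b d} → Coprime m n → n * a ≡ n * b + m * d → d ≡ 0 ⊎ n ≤ d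
n*a≡n*b+m*d⇒d≡0∨n≤d {d = zero}  _ _ = inj₁ refl
n*a≡n*b+m*d⇒d≡0∨n≤d {m} {n} {a} {b} {suc d} cop eq =
  inj₂ (∣⇒≤ (coprime-divisor (Coprimality.sym cop) n∣m*d))
  where
  n∣m*d : n ∣ m * suc d
  n∣m*d = ∣m+n∣m⇒∣n (subst (n ∣_) eq (m∣m*n a)) (m∣m*n b)

-- In the row equations, s = n ∸ k and r = n ∸ i count the rows below ε_k and ε_i,
-- and A, c are the lengths of those two rows.
row-equation-above : ∀ {r d A c} .{{_ : NonZero n}} → Coprime m n → suc r + d < n →
  m * (suc r + d) + n * A ≡ n * c + m * suc r → d ≡ 0 × A ≡ c
row-equation-above {n} {m} {r} {d} {A} {c} cop s<n eq =
  solution (n*a≡n*b+m*d⇒d≡0∨n≤d cop nc≡nA+md)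
  where
  open ≡-Reasoning
  nc≡nA+md : n * c ≡ n * A + m * d
  nc≡nA+md = +-cancelˡ-≡ (m * suc r) _ _ (begin
    m * suc r + n * c           ≡⟨ +-comm (m * suc r) (n * c) ⟩
    n * c + m * suc r           ≡⟨ eq ⟨
    m * (suc r + d) + n * A     ≡⟨ rearrange m (suc r) d n A ⟩
    m * suc r + (n * A + m * d) ∎)
    where
    rearrange : ∀ m p d n A → m * (p + d) + n * A ≡ m * p + (n * A + m * d)
    rearrange = solve-∀
  solution : d ≡ 0 ⊎ n ≤ d → d ≡ 0 × A ≡ c
  solution (inj₂ n≤d) = contradiction (≤-<-trans (m≤n+m d (suc r)) s<n) (≤⇒≯ n≤d)
  solution (inj₁ d≡0) = d≡0 , *-cancelˡ-≡ A c n (begin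
    n * A           ≡⟨ +-identityʳ (n * A) ⟨
    n * A + 0       ≡⟨ cong (_+_ (n * A)) (trans (cong (m *_) d≡0) (*-zeroʳ m)) ⟨
    n * A + m * d   ≡⟨ nc≡nA+md ⟨
    n * c           ∎)

row-equation-below : ∀ {s e A c} .{{_ : NonZero n}} → Coprime m n → s + e ≤ n →
  m * s + n * A ≡ n * c + m * (s + e) → (e ≡ 0 × A ≡ c) ⊎ (s ≡ 0 × e ≡ n × A ≡ c + m)
row-equation-below {n} {m} {s} {e} {A} {c} cop s+e≤n eq =
  solution (n*a≡n*b+m*d⇒d≡0∨n≤d cop nA≡nc+me)
  where
  open ≡-Reasoning
  nA≡nc+me : n * A ≡ n * c + m * e
  nA≡nc+me = +-cancelˡ-≡ (m * s) _ _ (begin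
    m * s + n * A               ≡⟨ eq ⟩
    n * c + m * (s + e)         ≡⟨ rearrange m s e n c ⟩
    m * s + (n * c + m * e)     ∎)
    where
    rearrange : ∀ m s e n c → n * c + m * (s + e) ≡ m * s + (n * c + m * e)
    rearrange = solve-∀
  e≤n : e ≤ n
  e≤n = ≤-trans (m≤n+m e s) s+e≤n
  solution : e ≡ 0 ⊎ n ≤ e → (e ≡ 0 × A ≡ c) ⊎ (s ≡ 0 × e ≡ n × A ≡ c + m)
  solution (inj₁ e≡0) = inj₁ (e≡0 , *-cancelˡ-≡ A c n (begin
    n * A           ≡⟨ nA≡nc+me ⟩
    n * c + m * e   ≡⟨ cong (λ t → n * c + m * t) e≡0 ⟩
    n * c + m * 0   ≡⟨ cong (_+_ (n * c)) (*-zeroʳ m) ⟩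
    n * c + 0       ≡⟨ +-identityʳ (n * c) ⟩
    n * c           ∎))
  solution (inj₂ n≤e) = inj₂ (s≡0 , e≡n , *-cancelˡ-≡ A (c + m) n (begin
    n * A           ≡⟨ nA≡nc+me ⟩
    n * c + m * e   ≡⟨ cong (λ t → n * c + m * t) e≡n ⟩
    n * c + m * n   ≡⟨ cong (_+_ (n * c)) (*-comm m n) ⟩
    n * c + n * m   ≡⟨ *-distribˡ-+ n c m ⟨
    n * (c + m)     ∎))
    where
    e≡n : e ≡ n
    e≡n = ≤-antisym e≤n n≤e
    s≡0 : s ≡ 0
    s≡0 = n≤0⇒n≡0 (+-cancelʳ-≤ e s 0 (≤-trans s+e≤n n≤e))

coprime-row-equation : ∀ {s r A c} .{{_ : NonZero n}} → Coprime m n → s < n → r < n →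
  m * s + n * A ≡ n * c + m * suc r →
  (s ≡ suc r × A ≡ c) ⊎ (suc r ≡ n × s ≡ 0 × A ≡ c + m)
coprime-row-equation {n} {m} {s} {r} {A} {c} cop s<n r<n eq with ≤-total (suc r) s
... | inj₁ 1+r≤s with m≤n⇒∃[o]m+o≡n 1+r≤s
...   | d , refl with row-equation-above cop s<n eq
...     | d≡0 , A≡c = inj₁ (trans (cong (_+_ (suc r)) d≡0) (+-identityʳ (suc r)) , A≡c)
coprime-row-equation {n} {m} {s} {r} {A} {c} cop s<n r<n eq
    | inj₂ s≤1+r with m≤n⇒∃[o]m+o≡n s≤1+r
... | e , s+e≡1+r
  with row-equation-below cop (subst (_≤ n) (sym s+e≡1+r) r<n)
         (subst (λ t → m * s + n * A ≡ n * c + m * t) (sym s+e≡1+r) eq)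
... | inj₁ (e≡0 , A≡c) =
  inj₁ (trans (sym (trans (cong (_+_ s) e≡0) (+-identityʳ s))) s+e≡1+r , A≡c)
... | inj₂ (s≡0 , e≡n , A≡c+m) = inj₂ (trans (sym s+e≡1+r) (cong₂ _+_ s≡0 e≡n) , s≡0 , A≡c+m)

row-equation-same : ∀ {r c} → m * r + n * c + n ≡ n * c + m * suc r → n ≡ m
row-equation-same {m} {n} {r} {c} eq = +-cancelˡ-≡ (m * r + n * c) n m (trans eq (rearrange m n r c))
  where
  rearrange : ∀ m n r c → n * c + m * suc r ≡ m * r + n * c + m
  rearrange = solve-∀

a-τ-≡ : ∀ n m i j Λ → a (τ n m i j Λ) i ≡ a Λ i ℤ.+ + n
a-τ-≡ n m i j Λ with i ≡ᵇ i | ≡⇒≡ᵇ i i refl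
... | true | _ = refl

a-τ-≢ : ∀ n m i j Λ → k ≢ i → a (τ n m i j Λ) k ≡ a Λ k
a-τ-≢ {k} n m i j Λ k≢i with k ≡ᵇ i | ≡ᵇ⇒≡ k i
... | false | _   = refl
... | true  | k≡i = contradiction (k≡i _) k≢i

b-τ-≡ : ∀ n m i j Λ → b (τ n m i j Λ) j ≡ b Λ j ℤ.+ + m
b-τ-≡ n m i j Λ with j ≡ᵇ j | ≡⇒≡ᵇ j j refl
... | true | _ = refl

-- Adding the box ε_i - δ_j to λ makes column δ_j one box longer, which is the m added by τ.
b-τ-x-corner : (lam : Vec ℕ n) → InX n m i j lam →
  b (τ n m i j (x n m lam)) j ≡ + (n * lam ! suc (n ∸ i) + m * suc (n ∸ i))
b-τ-x-corner {n} {m} {i} {j} lam (partition , c+1≡j , below) = begin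
  b (τ n m i j (x n m lam)) j           ≡⟨ b-τ-≡ n m i j (x n m lam) ⟩
  + (n * (j ∸ 1) + m * conj lam j + m) ≡⟨ cong₂ (λ c r → + (n * c + m * r + m)) j∸1≡c conj≡r ⟩
  + (n * c + m * r + m)                 ≡⟨ cong +_ (+-assoc (n * c) (m * r) m) ⟩
  + (n * c + (m * r + m))               ≡⟨ cong (λ t → + (n * c + t)) (+-comm (m * r) m) ⟩
  + (n * c + (m + m * r))               ≡⟨ cong (λ t → + (n * c + t)) (*-suc m r) ⟨
  + (n * c + m * suc r)                 ∎
  where
  open ≡-Reasoning
  r = n ∸ i
  c = lam ! suc r
  j∸1≡c : j ∸ 1 ≡ c
  j∸1≡c = trans (cong (_∸ 1) (sym c+1≡j)) (m+n∸n≡m c 1)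
  conj≡r : conj lam j ≡ r
  conj≡r = conj-≡ lam (partition⇒decreasing lam partition) (λ 1≤r → below (m∸n≢0⇒n<m (>⇒≢ 1≤r)))
             (subst (c <_) c+1≡j (m<m+n c (s≤s z≤n)))

adjacent-row : (lam : Vec ℕ n) → k ≤ n → suc k ≡ i → lam ! suc (n ∸ k) ≡ lam ! suc (n ∸ i) →
  suc k ≡ i × lam ! suc (n ∸ i) ≡ lam ! (suc (suc n) ∸ i) × (k , j) ≡ (i ∸ 1 , j)
adjacent-row lam k≤n refl A≡c =
  refl , trans (sym A≡c) (cong (lam !_) (sym (+-∸-assoc 1 k≤n))) , refl

hook-row : (lam : Vec ℕ n) → 1 ≤ n → IsPartition n m lam → OuterCorner n m i j lam →
  1 ≡ i → k ≡ n → lam ! 1 ≡ lam ! suc (n ∸ i) + m →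
  (i , j) ≡ (1 , 1) × (k , j) ≡ (n , 1) × lam ! 1 ≡ m × lam ! n ≡ 0 × hook n m ⊆ tα i j lam
hook-row {suc p} {m} {j = j} lam _ partition@(_ , lam₁≤m) (c+1≡j , below) refl refl lam₁≡c+m =
  cong (1 ,_) j≡1 , cong (suc p ,_) j≡1 , lam₁≡m , c≡0 ,
  hook-⊆-incAt lam (partition⇒decreasing lam partition) (≤-reflexive (sym lam₁≡m)) 1≤lamₚ
  where
  c≡0 : lam ! suc p ≡ 0
  c≡0 = n≤0⇒n≡0 (+-cancelʳ-≤ m _ 0 (subst (_≤ m) lam₁≡c+m lam₁≤m))
  j≡1 : j ≡ 1
  j≡1 = trans (sym c+1≡j) (cong (_+ 1) c≡0)
  lam₁≡m : lam ! 1 ≡ m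
  lam₁≡m = trans lam₁≡c+m (cong (_+ m) c≡0)
  1≤lamₚ : 1 ≤ p → 1 ≤ lam ! p
  1≤lamₚ 1≤p = subst (_≤ lam ! p) j≡1 (below (s≤s 1≤p))

lemma4p8 : (n m : ℕ) → 1 ≤ n → n < m → Coprime m n →
    (i j : ℕ) → 1 ≤ i → i ≤ n → 1 ≤ j → j ≤ m →
    (lam : Vec ℕ n) → InX n m i j lam →
    (k : ℕ) → 1 ≤ k → k ≤ n →
    pair (τ n m i j (x n m lam)) k j ≡ 0ℤ →
    (suc k ≡ i × lam ! (suc (n ∸ i)) ≡ lam ! (suc (suc n) ∸ i) × (k , j) ≡ (i ∸ 1 , j))
    ⊎ ((i , j) ≡ (1 , 1) × (k , j) ≡ (n , 1) × lam ! 1 ≡ m × lam ! n ≡ 0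
       × hook n m ⊆ tα i j lam)
lemma4p8 n m 1≤n n<m cop i j 1≤i i≤n _ _ lam inX@(partition , corner) k 1≤k k≤n pair≡0
  with k ≟ i | trans (i-j≡0⇒i≡j _ _ pair≡0) (b-τ-x-corner lam inX)
... | yes refl | a≡b =
  ⊥-elim (<⇒≢ n<m (row-equation-same (+-injective (trans (sym (a-τ-≡ n m i j (x n m lam))) a≡b))))
... | no k≢i | a≡b
  with coprime-row-equation {{>-nonZero 1≤n}} cop (∸-monoʳ-< 1≤k k≤n) (∸-monoʳ-< 1≤i i≤n)
         (+-injective (trans (sym (a-τ-≢ n m i j (x n m lam) k≢i)) a≡b))
... | inj₁ (s≡1+r , A≡c) = inj₁ (adjacent-row lam k≤n (∸≡suc[∸]⇒suc≡ i≤n s≡1+r) A≡c)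
... | inj₂ (1+r≡n , s≡0 , A≡c+m) =
  inj₂ (hook-row lam 1≤n partition corner (∸≡suc[∸]⇒suc≡ i≤n (sym 1+r≡n))
                 (≤-antisym k≤n (m∸n≡0⇒m≤n s≡0)) (subst (λ t → lam ! suc t ≡ lam ! suc (n ∸ i) + m) s≡0 A≡c+m))
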